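{- In a deduction in $\mathbf{I}$ in normal form, if any major premises of elimination rules lie on a branch, then they precede (on that branch) all major assumptions discharged by introduction rules that lie on the branch.
   Context: Formulas of intuitionistic propositional logic are built from atomic formulas using the connectives $\bot$ (0-ary), $\land$, $\lor$, $\supset$; $\bot$ is not atomic. The natural deduction system $\mathbf{I}$ has tree-shaped deductions with assumptions at the leaves, grouped into assumption classes (occurrences of the same formula; a rule discharging a class discharges all its members). Rules: - $\land I$: from deductions of $A$, of $B$, and of $C$ from $[A\land B]$, conclude $C$. - $\supset I$: from a deduction of $B$ from $[A]$ and a deduction of $C$ from $[A\supset B]$, conclude $C$. - $\lor I$: from a deduction of $A$ (or of $B$) and a deduction of $C$ from $[A\lor B]$, conclude $C$. - $\land E$: from $A\land B$ and a deduction of $C$ from $[A],[B]$, conclude $C$. - $\supset E$: from $A\supset B$, $A$, and a deduction of $C$ from $[B]$, conclude $C$. - $\lor E$: from $A\lor B$, a deduction of $C$ from $[A]$ and one of $C$ from $[B]$, conclude $C$. - $\bot E$: from $\bot$ conclude $C$. A single assumption occurrence is a deduction. Standing conventions: no vacuous discharge above arbitrary premises; $\bot E$ has atomic conclusions. Terminology: in elimination rules, $A\land B,A\supset B,A\lor B,\bot$ are major premises, the $C$'s arbitrary premises, and $A$ in $\supset E$ the minor premise. In introduction rules, the premises $A$, $B$ other than $C$ are specific premises, $C$ is the arbitrary premise, the discharged $A\land B, A\supset B, A\lor B$ are major assumptions discharged, and the discharged $A$ of $\supset I$ are minor assumptions discharged. A maximal formula with main operator $\ast$ is an occurrence of $A\ast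 B$ that is both the major premise of $\ast E$ and a major assumption discharged by $\ast I$. A segment is a sequence $C_1,\dots,C_n$ ($n>1$) of occurrences of the same formula, each $C_i$ ($i<n$) an arbitrary premise of a rule with conclusion $C_{i+1}$, and $C_n$ not an arbitrary premise. A maximal segment is a segment whose last formula is the major premise of an elimination rule. A deduction is in normal form if it contains no maximal formula and no maximal segment. A branch in a deduction is a sequence of formula occurrences $\sigma_1,\dots,\sigma_n$ such that $\sigma_1$ is an assumption that is neither discharged by an elimination rule nor a major assumption discharged by an introduction rule; $\sigma_n$ is either the conclusion of the deduction or the minor premise of an application of $\supset E$; and for each $i<n$: if $\sigma_i$ is the major premise of an elimination rule other than $\bot E$, $\sigma_{i+1}$ is an assumption discharged by it; if it is the major premise of $\bot E$, $\sigma_{i+1}$ is the conclusion of that rule; if $\sigma_i$ is a specific premise of an introduction rule, $\sigma_{i+1}$ is a major assumption discharged by it; if $\sigma_i$ is an arbitrary premise (of any rule), $\sigma_{i+1}$ is the conclusion of that rule. -}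

module Defs where

open import Data.Nat using (ℕ; _≤_; _<_)
open import Data.List using (List; []; _∷_; _++_; [_]; length; last)
open import Data.List.Membership.Propositional using (_∈_)
open import Data.List.Relation.Unary.All using (All)
open import Data.List.Relation.Unary.Linked using (Linked)
open import Data.Maybe using (Maybe; just; nothing; _>>=_)
open import Data.Product using (Σ; ∃; _×_; _,_; proj₁; proj₂)
open import Data.Sum using (_⊎_)
open import Relation.Nullary using (¬_)
open import Relation.Binary.PropositionalEquality using (_≡_; _≢_)

infixr 6 _∧'_
infixr 5 _∨'_
infixr 4 _⊃_

data Formula : Set where
  atom : ℕ → Formula
  ⊥'   : Formula
  _∧'_ : Formula → Formula → Formula
  _∨'_ : Formula → Formula → Formula
  _⊃_  : Formula → Formula → Formula

data Atomic : Formula → Set where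
  atom : (n : ℕ) → Atomic (atom n)

-- Deductions of the system I (general introduction / elimination rules).
-- Assumption occurrences carry a label; an assumption class is the set of
-- occurrences  ass x A  with the same label x and formula A.  A rule
-- discharging the class (x , A) in one of its premise-subdeductions
-- discharges all members of that class occurring free there.

Label : Set
Label = ℕ

data Ded : Formula → Set where
  ass : (x : Label) (A : Formula) → Ded A
  -- ∧I : A , B , [A ∧ B]^x ... C  ⊢ C
  ∧I  : ∀ {A B C} → Ded A → Ded B → (x : Label) → Ded C → Ded C
  -- ⊃I : [A]^y ... B , [A ⊃ B]^x ... C  ⊢ C
  ⊃I  : ∀ {B C} (A : Formula) (y : Label) → Ded B → (x : Label) → Ded C → Ded C
  -- ∨I : A (resp. B) , [A ∨ B]^x ... C ⊢ C
  ∨I₁ : ∀ {A C} (B : Formula) → Ded A → (x : Label) → Ded C → Ded C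
  ∨I₂ : ∀ {B C} (A : Formula) → Ded B → (x : Label) → Ded C → Ded C
  -- ∧E : A ∧ B , [A]^x [B]^y ... C ⊢ C
  ∧E  : ∀ {A B C} → Ded (A ∧' B) → (x y : Label) → Ded C → Ded C
  -- ⊃E : A ⊃ B , A , [B]^x ... C ⊢ C
  ⊃E  : ∀ {A B C} → Ded (A ⊃ B) → Ded A → (x : Label) → Ded C → Ded C
  -- ∨E : A ∨ B , [A]^x ... C , [B]^y ... C ⊢ C
  ∨E  : ∀ {A B C} → Ded (A ∨' B) → (x : Label) → Ded C → (y : Label) → Ded C → Ded C
  ⊥E  : ∀ {C} → Ded ⊥' → Atomic C → Ded C

-- A node of a deduction tree (= a formula occurrence, namely the
-- conclusion of the subdeduction rooted there).
Node : Set
Node = Σ Formula Ded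

-- i-th premise (immediate subdeduction), premises numbered from 0 in the
-- order of the constructor arguments above.
child : ∀ {C} → Ded C → ℕ → Maybe Node
child (ass x A)         _ = nothing
child (∧I a b x c)      0 = just (_ , a)
child (∧I a b x c)      1 = just (_ , b)
child (∧I a b x c)      2 = just (_ , c)
child (⊃I A y b x c)    0 = just (_ , b)
child (⊃I A y b x c)    1 = just (_ , c)
child (∨I₁ B a x c)     0 = just (_ , a)
child (∨I₁ B a x c)     1 = just (_ , c)
child (∨I₂ A b x c)     0 = just (_ , b)
child (∨I₂ A b x c)     1 = just (_ , c)
child (∧E m x y c)      0 = just (_ , m)
child (∧E m x y c)      1 = just (_ , c)
child (⊃E m a x c)      0 = just (_ , m)
child (⊃E m a x c)      1 = just (_ , a)
child (⊃E m a x c)      2 = just (_ , c)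
child (∨E m x c y e)    0 = just (_ , m)
child (∨E m x c y e)    1 = just (_ , c)
child (∨E m x c y e)    2 = just (_ , e)
child (⊥E m at)         0 = just (_ , m)
child _                 _ = nothing

-- Positions (formula occurrences) are paths from the root.
Path : Set
Path = List ℕ

sub : ∀ {C} → Ded C → Path → Maybe Node
sub d []      = just (_ , d)
sub d (i ∷ p) = child d i >>= λ n → sub (proj₂ n) p

At : ∀ {C} → Ded C → Path → Node → Set
At d p n = sub d p ≡ just n

FormulaAt : ∀ {C} → Ded C → Path → Formula → Set
FormulaAt d p A = ∃ λ (e : Ded A) → At d p (A , e)

data RuleKind : Set where
  assumption intro elim botElim : RuleKind

kind : ∀ {C} → Ded C → RuleKind
kind (ass x A)      = assumption
kind (∧I _ _ _ _)   = intro
kind (⊃I _ _ _ _ _) = intro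
kind (∨I₁ _ _ _ _)  = intro
kind (∨I₂ _ _ _ _)  = intro
kind (∧E _ _ _ _)   = elim
kind (⊃E _ _ _ _)   = elim
kind (∨E _ _ _ _ _) = elim
kind (⊥E _ _)       = botElim

data Role : Set where
  major minor specific arbitrary : Role

role : ∀ {C} → Ded C → ℕ → Maybe Role
role (∧I _ _ _ _)   0 = just specific
role (∧I _ _ _ _)   1 = just specific
role (∧I _ _ _ _)   2 = just arbitrary
role (⊃I _ _ _ _ _) 0 = just specific
role (⊃I _ _ _ _ _) 1 = just arbitrary
role (∨I₁ _ _ _ _)  0 = just specific
role (∨I₁ _ _ _ _)  1 = just arbitrary
role (∨I₂ _ _ _ _)  0 = just specific
role (∨I₂ _ _ _ _)  1 = just arbitrary
role (∧E _ _ _ _)   0 = just major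
role (∧E _ _ _ _)   1 = just arbitrary
role (⊃E _ _ _ _)   0 = just major
role (⊃E _ _ _ _)   1 = just minor
role (⊃E _ _ _ _)   2 = just arbitrary
role (∨E _ _ _ _ _) 0 = just major
role (∨E _ _ _ _ _) 1 = just arbitrary
role (∨E _ _ _ _ _) 2 = just arbitrary
role (⊥E _ _)       0 = just major
role _              _ = nothing

-- Kinds of discharged assumptions: major assumptions discharged by an
-- introduction rule, minor assumptions (the [A] of ⊃I), and assumptions
-- discharged by an elimination rule.
data DKind : Set where
  majorAss minorAss elimAss : DKind

binds : ∀ {C} → Ded C → ℕ → List (Label × Formula × DKind)
binds (∧I {A} {B} _ _ x _)   2 = (x , (A ∧' B) , majorAss) ∷ []
binds (⊃I A y _ _ _)         0 = (y , A , minorAss) ∷ []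
binds (⊃I {B} A _ _ x _)     1 = (x , (A ⊃ B) , majorAss) ∷ []
binds (∨I₁ {A} B _ x _)      1 = (x , (A ∨' B) , majorAss) ∷ []
binds (∨I₂ {B} A _ x _)      1 = (x , (A ∨' B) , majorAss) ∷ []
binds (∧E {A} {B} _ x y _)   1 = (x , A , elimAss) ∷ (y , B , elimAss) ∷ []
binds (⊃E {A} {B} _ _ x _)   2 = (x , B , elimAss) ∷ []
binds (∨E {A} {B} _ x _ _ _) 1 = (x , A , elimAss) ∷ []
binds (∨E {A} {B} _ _ _ y _) 2 = (y , B , elimAss) ∷ []
binds _                      _ = []

Binds : ∀ {C} → Ded C → Path → ℕ → Label → Formula → Set
Binds d q i x A = ∃ λ n → ∃ λ k → At d q n × (x , A , k) ∈ binds (proj₂ n) i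

-- The assumption occurrence at p is discharged (with kind k) by the rule at
-- q, in the i-th premise of that rule: p lies in that premise, it belongs
-- to a class discharged there, and no rule strictly between q and p
-- discharges the same class (innermost binder).
DischargedBy : ∀ {C} → Ded C → Path → ℕ → Path → DKind → Set
DischargedBy d q i p k =
  ∃ λ r → ∃ λ x → ∃ λ A → ∃ λ n →
    p ≡ q ++ i ∷ r ×
    At d p (A , ass x A) ×
    At d q n ×
    (x , A , k) ∈ binds (proj₂ n) i ×
    (∀ q' j r' → p ≡ q' ++ j ∷ r' → length q < length q' → ¬ Binds d q' j x A)

PremiseOf : ∀ {C} → Ded C → Path → Path → Role → Set
PremiseOf d p q r = ∃ λ i → ∃ λ n →
  p ≡ q ++ [ i ] × At d q n × role (proj₂ n) i ≡ just r

KindAt : ∀ {C} → Ded C → Path → RuleKind → Set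
KindAt d q k = ∃ λ n → At d q n × kind (proj₂ n) ≡ k

IsAssumption : ∀ {C} → Ded C → Path → Set
IsAssumption d p = ∃ λ x → ∃ λ A → At d p (A , ass x A)

MajorPremiseElim : ∀ {C} → Ded C → Path → Set
MajorPremiseElim d p = ∃ λ q →
  PremiseOf d p q major × (KindAt d q elim ⊎ KindAt d q botElim)

MajorAssIntro : ∀ {C} → Ded C → Path → Set
MajorAssIntro d p = ∃ λ q → ∃ λ i → DischargedBy d q i p majorAss × KindAt d q intro

NoVacuousDischarge : ∀ {C} → Ded C → Set
NoVacuousDischarge d = ∀ q n i → At d q n →
  role (proj₂ n) i ≡ just arbitrary → binds (proj₂ n) i ≢ [] →
  ∃ λ p → ∃ λ k → DischargedBy d q i p k

MaximalFormula : ∀ {C} → Ded C → Path → Set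
MaximalFormula d p = MajorPremiseElim d p × MajorAssIntro d p

ArbitraryPremise : ∀ {C} → Ded C → Path → Set
ArbitraryPremise d p = ∃ λ q → PremiseOf d p q arbitrary

Segment : ∀ {C} → Ded C → List Path → Set
Segment d σ =
  2 ≤ length σ ×
  (∃ λ A → All (λ p → FormulaAt d p A) σ) ×
  Linked (λ p p' → PremiseOf d p p' arbitrary) σ ×
  (∃ λ t → last σ ≡ just t × ¬ ArbitraryPremise d t)

MaximalSegment : ∀ {C} → Ded C → List Path → Set
MaximalSegment d σ = Segment d σ × (∃ λ t → last σ ≡ just t × MajorPremiseElim d t)

Normal : ∀ {C} → Ded C → Set
Normal d = (∀ p → ¬ MaximalFormula d p) × (∀ σ → ¬ MaximalSegment d σ)

data Step {C} (d : Ded C) (p : Path) : Path → Set where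
  elimStep  : ∀ {q i p' k} → PremiseOf d p q major → KindAt d q elim →
              DischargedBy d q i p' k → Step d p p'
  botStep   : ∀ {q} → PremiseOf d p q major → KindAt d q botElim → Step d p q
  introStep : ∀ {q i p'} → PremiseOf d p q specific → KindAt d q intro →
              DischargedBy d q i p' majorAss → Step d p p'
  arbStep   : ∀ {q} → PremiseOf d p q arbitrary → Step d p q

BranchStart : ∀ {C} → Ded C → Path → Set
BranchStart d p =
  IsAssumption d p ×
  ¬ (∃ λ q → ∃ λ i → ∃ λ k → DischargedBy d q i p k × (KindAt d q elim ⊎ KindAt d q botElim)) ×
  ¬ MajorAssIntro d p

BranchEnd : ∀ {C} → Ded C → Path → Set
BranchEnd d p = p ≡ [] ⊎ (∃ λ q → PremiseOf d p q minor × KindAt d q elim)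

Branch : ∀ {C} → Ded C → List Path → Set
Branch d σ =
  (∃ λ s → ∃ λ ss → σ ≡ s ∷ ss × BranchStart d s) ×
  Linked (Step d) σ ×
  (∃ λ t → last σ ≡ just t × BranchEnd d t)

-- Once a branch reaches a major assumption discharged by an introduction,
-- each further occurrence is again such an assumption or the conclusion of a
-- rule entered through an arbitrary premise, because a branch leaves any
-- other occurrence only as the major premise of an elimination.  In a normal
-- deduction neither kind of occurrence is such a major premise: the first
-- would be a maximal formula, the second would end a maximal segment of
-- length two.
module Submission where

open import Defs
open import Data.List using (List; []; _∷_; _++_; [_]; length; lookup)
open import Data.List.Properties using (∷ʳ-injective)
open import Data.List.Relation.Unary.Linked using (Linked; [-]; _∷_)
open import Data.List.Relation.Unary.All using ([]; _∷_)
open import Data.Fin using (Fin; zero; suc; _<_; _≤_)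
open import Data.Fin.Properties using (_<?_)
open import Data.Nat using (ℕ; z≤n; s≤s)
open import Data.Nat.Properties using (≮⇒≥)
open import Data.Maybe using (just; nothing; _>>=_)
open import Data.Maybe.Properties using (just-injective)
open import Data.Product using (∃; _,_; proj₂)
open import Data.Sum using (_⊎_; inj₁; inj₂)
open import Data.Empty using (⊥-elim)
open import Relation.Nullary using (¬_; yes; no)
open import Relation.Binary.PropositionalEquality using (_≡_; refl; sym; trans; cong; module ≡-Reasoning)

Linked-lookup-preserves : ∀ {A : Set} {R : A → A → Set} {G : A → Set} →
  (∀ {x y} → G x → R x y → G y) →
  ∀ {xs : List A} → Linked R xs → (j i : Fin (length xs)) → j ≤ i →
  G (lookup xs j) → G (lookup xs i)
Linked-lookup-preserves step {_ ∷ _}     _        zero    zero    _         g = g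
Linked-lookup-preserves step {_ ∷ _ ∷ _} (r ∷ rs) zero    (suc i) _         g =
  Linked-lookup-preserves step rs zero i z≤n (step g r)
Linked-lookup-preserves step {_ ∷ _ ∷ _} (_ ∷ rs) (suc j) (suc i) (s≤s j≤i) g =
  Linked-lookup-preserves step rs j i j≤i g

sub-++ : ∀ {C} (d : Ded C) p q → sub d (p ++ q) ≡ (sub d p >>= λ n → sub (proj₂ n) q)
sub-++ d []      q = refl
sub-++ d (i ∷ p) q with child d i
... | nothing = refl
... | just n  = sub-++ (proj₂ n) p q

arbitrary-premise-conclusion : ∀ {C} (e : Ded C) i → role e i ≡ just arbitrary →
  ∃ λ e' → child e i ≡ just (C , e')
arbitrary-premise-conclusion (ass x A) i ()
arbitrary-premise-conclusion (∧I a b x c) 0 ()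
arbitrary-premise-conclusion (∧I a b x c) 1 ()
arbitrary-premise-conclusion (∧I a b x c) 2 refl = c , refl
arbitrary-premise-conclusion (∧I a b x c) (ℕ.suc (ℕ.suc (ℕ.suc i))) ()
arbitrary-premise-conclusion (⊃I A y b x c) 0 ()
arbitrary-premise-conclusion (⊃I A y b x c) 1 refl = c , refl
arbitrary-premise-conclusion (⊃I A y b x c) (ℕ.suc (ℕ.suc i)) ()
arbitrary-premise-conclusion (∨I₁ B a x c) 0 ()
arbitrary-premise-conclusion (∨I₁ B a x c) 1 refl = c , refl
arbitrary-premise-conclusion (∨I₁ B a x c) (ℕ.suc (ℕ.suc i)) ()
arbitrary-premise-conclusion (∨I₂ A b x c) 0 ()
arbitrary-premise-conclusion (∨I₂ A b x c) 1 refl = c , refl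
arbitrary-premise-conclusion (∨I₂ A b x c) (ℕ.suc (ℕ.suc i)) ()
arbitrary-premise-conclusion (∧E m x y c) 0 ()
arbitrary-premise-conclusion (∧E m x y c) 1 refl = c , refl
arbitrary-premise-conclusion (∧E m x y c) (ℕ.suc (ℕ.suc i)) ()
arbitrary-premise-conclusion (⊃E m a x c) 0 ()
arbitrary-premise-conclusion (⊃E m a x c) 1 ()
arbitrary-premise-conclusion (⊃E m a x c) 2 refl = c , refl
arbitrary-premise-conclusion (⊃E m a x c) (ℕ.suc (ℕ.suc (ℕ.suc i))) ()
arbitrary-premise-conclusion (∨E m x c y e) 0 ()
arbitrary-premise-conclusion (∨E m x c y e) 1 refl = c , refl
arbitrary-premise-conclusion (∨E m x c y e) 2 refl = e , refl
arbitrary-premise-conclusion (∨E m x c y e) (ℕ.suc (ℕ.suc (ℕ.suc i))) ()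
arbitrary-premise-conclusion (⊥E m at) 0 ()
arbitrary-premise-conclusion (⊥E m at) (ℕ.suc i) ()

arbitrary-premise-formula : ∀ {C} (d : Ded C) {p q A} {e : Ded A} →
  PremiseOf d p q arbitrary → At d q (A , e) → FormulaAt d p A
arbitrary-premise-formula d {q = q} (i , n , refl , at-n , rl) at
  with trans (sym at) at-n
... | refl with arbitrary-premise-conclusion _ i rl
...   | e' , child≡ = e' , (begin
  sub d (q ++ [ i ])                         ≡⟨ sub-++ d q [ i ] ⟩
  (sub d q >>= λ m → sub (proj₂ m) [ i ])    ≡⟨ cong (_>>= λ m → sub (proj₂ m) [ i ]) at ⟩
  (child (proj₂ n) i >>= λ m → just m)       ≡⟨ cong (_>>= just) child≡ ⟩
  just (_ , e')                              ∎)
  where open ≡-Reasoning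

PremiseOf-role-unique : ∀ {C} (d : Ded C) {p q q' r r'} →
  PremiseOf d p q r → PremiseOf d p q' r' → r ≡ r'
PremiseOf-role-unique d {q = q} {q' = q'} (i , n , refl , at , rl) (_ , _ , p≡ , at' , rl')
  with ∷ʳ-injective q q' p≡
... | refl , refl with trans (sym at) at'
... | refl = just-injective (trans (sym rl) rl')

ArbitraryConclusion : ∀ {C} → Ded C → Path → Set
ArbitraryConclusion d q = ∃ λ p → PremiseOf d p q arbitrary

arbitrary-conclusion-major⇒maximal-segment : ∀ {C} (d : Ded C) {p q} →
  PremiseOf d p q arbitrary → MajorPremiseElim d q → MaximalSegment d (p ∷ q ∷ [])
arbitrary-conclusion-major⇒maximal-segment d pq@(_ , (A , e) , _ , at , _) mpe@(_ , major-q , _) =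
  (s≤s (s≤s z≤n) , (A , arbitrary-premise-formula d pq at ∷ (e , at) ∷ []) , pq ∷ [-] ,
   (_ , refl , q-not-arbitrary)) ,
  (_ , refl , mpe)
  where
    q-not-arbitrary : ¬ ArbitraryPremise d _
    q-not-arbitrary (_ , arb-q) with PremiseOf-role-unique d arb-q major-q
    ... | ()

IntroOrArbitraryConclusion : ∀ {C} → Ded C → Path → Set
IntroOrArbitraryConclusion d p = MajorAssIntro d p ⊎ ArbitraryConclusion d p

normal⇒¬MajorPremiseElim : ∀ {C} (d : Ded C) → Normal d → ∀ {p} →
  IntroOrArbitraryConclusion d p → ¬ MajorPremiseElim d p
normal⇒¬MajorPremiseElim d (no-max-formula , _) {p} (inj₁ mai) mpe = no-max-formula p (mpe , mai)
normal⇒¬MajorPremiseElim d (_ , no-max-segment) (inj₂ (_ , pq)) mpe =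
  no-max-segment _ (arbitrary-conclusion-major⇒maximal-segment d pq mpe)

Step-preserves-IntroOrArbitraryConclusion : ∀ {C} (d : Ded C) → Normal d → ∀ {p p'} →
  IntroOrArbitraryConclusion d p → Step d p p' → IntroOrArbitraryConclusion d p'
Step-preserves-IntroOrArbitraryConclusion d nf g (elimStep p-major k _) =
  ⊥-elim (normal⇒¬MajorPremiseElim d nf g (_ , p-major , inj₁ k))
Step-preserves-IntroOrArbitraryConclusion d nf g (botStep p-major k) =
  ⊥-elim (normal⇒¬MajorPremiseElim d nf g (_ , p-major , inj₂ k))
Step-preserves-IntroOrArbitraryConclusion d nf g (introStep _ k dis) = inj₁ (_ , _ , dis , k)
Step-preserves-IntroOrArbitraryConclusion d nf g (arbStep pq)        = inj₂ (_ , pq)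

-- The convention against vacuous discharge is not needed for this result.
corollary2 : ∀ {C} (d : Ded C) → NoVacuousDischarge d → Normal d →
    ∀ (σ : List Path) → Branch d σ →
    ∀ (i j : Fin (length σ)) →
    MajorPremiseElim d (lookup σ i) → MajorAssIntro d (lookup σ j) → i < j
corollary2 d _ nf σ (_ , steps , _) i j mpe mai with i <? j
... | yes i<j = i<j
... | no  i≮j = ⊥-elim (normal⇒¬MajorPremiseElim d nf intro-or-arb-at-i mpe)
  where
    intro-or-arb-at-i : IntroOrArbitraryConclusion d (lookup σ i)
    intro-or-arb-at-i =
      Linked-lookup-preserves (Step-preserves-IntroOrArbitraryConclusion d nf)
        steps j i (≮⇒≥ i≮j) (inj₁ mai)
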